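{- Let $\mathsf V$ be a 1ESP variety and let $h$ be an algebraic e-generalization problem for $\mathsf V$. Then the poset $(\mathscr A(h),\sqsubseteq)$ of solutions of $h$ is dually isomorphic to the poset $(\mathscr G(h),\subseteq)$ (via $g\mapsto\ker(g)$).
   Context: $\mathbf F_{\mathsf V}(z)$ is the 1-generated free algebra of $\mathsf V$. Projective in $\mathsf V$ = retract of a free algebra ($i:\mathbf P\to\mathbf F$, $j:\mathbf F\to\mathbf P$, $j\circ i=\mathrm{id}$); exact = isomorphic to a finitely generated subalgebra of a finitely generated free algebra. An algebraic e-generalization problem is a homomorphism $h:\mathbf F_{\mathsf V}(z)\to\prod_{k=1}^m\mathbf E_k$ ($m\ge1$), each $\mathbf E_k$ 1-generated exact, each $p_k\circ h$ surjective. A solution is a homomorphism $g:\mathbf F_{\mathsf V}(z)\to\mathbf P$, $\mathbf P$ finitely generated projective, with $f\circ g=h$ for some homomorphism $f:\mathbf P\to\prod_k\mathbf E_k$. $g\sqsubseteq g'$ iff $f\circ g'=g$ for some homomorphism $f$; $(\mathscr A(h),\sqsubseteq)$ is the poset of solutions modulo equal generality. $\mathscr G(h)=\{\ker(g): g\text{ a solution of }h\}\subseteq\mathrm{Con}(\mathbf F_{\mathsf V}(z))$. An algebra $\mathbf S\in\mathsf V$ is strongly projective if it is projective and for every embedding $i:\mathbf S\to\mathbf P$ into a projective algebra $\mathbf P$ there is a homomorphism $j:\mathbf P\to\mathbf S$ with $j\circ i=\mathrm{id}_{\mathbf S}$. $\mathsf V$ is 1ESP if every 1-generated exact algebra in $\mathsf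 V$ is strongly projective. -}

module Defs where

open import Data.Nat using (ℕ; suc)
open import Data.Fin using (Fin)
open import Data.Unit using (⊤; tt)
open import Data.Product using (Σ; _×_; _,_)
open import Relation.Binary using (IsEquivalence)

record Signature : Set₁ where
  field
    Op    : Set
    arity : Op → ℕ
open Signature public

data Term (σ : Signature) (X : Set) : Set where
  var : X → Term σ X
  op  : (f : Op σ) → (Fin (arity σ f) → Term σ X) → Term σ X

subst : ∀ {σ X Y} → (X → Term σ Y) → Term σ X → Term σ Y
subst ρ (var x)   = ρ x
subst ρ (op f ts) = op f (λ i → subst ρ (ts i))

record Algebra (σ : Signature) : Set₁ where
  field
    Carrier : Set
    _≈_     : Carrier → Carrier → Set
    isEquiv : IsEquivalence _≈_
    ⟦_⟧     : (f : Op σ) → (Fin (arity σ f) → Carrier) → Carrier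
    ⟦⟧-cong : ∀ f {as bs : Fin (arity σ f) → Carrier} →
              (∀ i → as i ≈ bs i) → ⟦ f ⟧ as ≈ ⟦ f ⟧ bs
open Algebra public

eval : ∀ {σ X} (A : Algebra σ) → (X → Carrier A) → Term σ X → Carrier A
eval A ρ (var x)   = ρ x
eval A ρ (op f ts) = ⟦ A ⟧ f (λ i → eval A ρ (ts i))

record Hom {σ : Signature} (A B : Algebra σ) : Set where
  field
    fun     : Carrier A → Carrier B
    fun-cong : ∀ {a b} → _≈_ A a b → _≈_ B (fun a) (fun b)
    fun-op  : ∀ f (as : Fin (arity σ f) → Carrier A) →
              _≈_ B (fun (⟦ A ⟧ f as)) (⟦ B ⟧ f (λ i → fun (as i)))
open Hom public

idH : ∀ {σ} (A : Algebra σ) → Hom A A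
idH A = record
  { fun = λ a → a ; fun-cong = λ p → p
  ; fun-op = λ f as → IsEquivalence.refl (isEquiv A) }

_∘H_ : ∀ {σ} {A B C : Algebra σ} → Hom B C → Hom A B → Hom A C
_∘H_ {C = C} g f = record
  { fun = λ a → fun g (fun f a)
  ; fun-cong = λ p → fun-cong g (fun-cong f p)
  ; fun-op = λ o as → IsEquivalence.trans (isEquiv C)
                         (fun-cong g (fun-op f o as)) (fun-op g o _) }

_≗H_ : ∀ {σ} {A B : Algebra σ} → Hom A B → Hom A B → Set
_≗H_ {A = A} {B} f g = ∀ a → _≈_ B (fun f a) (fun g a)

Injective : ∀ {σ} {A B : Algebra σ} → Hom A B → Set
Injective {A = A} {B} f = ∀ a b → _≈_ B (fun f a) (fun f b) → _≈_ A a b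

Surjective : ∀ {σ} {A B : Algebra σ} → Hom A B → Set
Surjective {A = A} {B} f = ∀ b → Σ (Carrier A) λ a → _≈_ B (fun f a) b

-- Varieties, given (Birkhoff) by a set of equations over variables ℕ

record Variety : Set₁ where
  field
    sig : Signature
    Eqn : Set
    lhs : Eqn → Term sig ℕ
    rhs : Eqn → Term sig ℕ
open Variety public

data _⊢_≈_ (V : Variety) {X : Set} : Term (sig V) X → Term (sig V) X → Set where
  ≈refl  : ∀ {t} → V ⊢ t ≈ t
  ≈sym   : ∀ {s t} → V ⊢ s ≈ t → V ⊢ t ≈ s
  ≈trans : ∀ {s t u} → V ⊢ s ≈ t → V ⊢ t ≈ u → V ⊢ s ≈ u
  ≈cong  : ∀ f {ss ts : Fin (arity (sig V) f) → Term (sig V) X} →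
           (∀ i → V ⊢ ss i ≈ ts i) → V ⊢ op f ss ≈ op f ts
  ≈axiom : ∀ (e : Eqn V) (ρ : ℕ → Term (sig V) X) →
           V ⊢ subst ρ (lhs V e) ≈ subst ρ (rhs V e)

-- the free algebra F_V(X) (term algebra modulo the equational theory of V)
Free : (V : Variety) → Set → Algebra (sig V)
Free V X = record
  { Carrier = Term (sig V) X
  ; _≈_ = V ⊢_≈_
  ; isEquiv = record { refl = ≈refl ; sym = ≈sym ; trans = ≈trans }
  ; ⟦_⟧ = op
  ; ⟦⟧-cong = ≈cong }

F₁ : (V : Variety) → Algebra (sig V)
F₁ V = Free V ⊤

Π : ∀ {σ} {m : ℕ} → (Fin m → Algebra σ) → Algebra σ
Π {σ} {m} E = record
  { Carrier = (k : Fin m) → Carrier (E k)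
  ; _≈_ = λ a b → ∀ k → _≈_ (E k) (a k) (b k)
  ; isEquiv = record
      { refl = λ k → IsEquivalence.refl (isEquiv (E k))
      ; sym = λ p k → IsEquivalence.sym (isEquiv (E k)) (p k)
      ; trans = λ p q k → IsEquivalence.trans (isEquiv (E k)) (p k) (q k) }
  ; ⟦_⟧ = λ f as k → ⟦ E k ⟧ f (λ i → as i k)
  ; ⟦⟧-cong = λ f ps k → ⟦⟧-cong (E k) f (λ i → ps i k) }

proj : ∀ {σ} {m : ℕ} (E : Fin m → Algebra σ) (k : Fin m) → Hom (Π E) (E k)
proj E k = record
  { fun = λ a → a k ; fun-cong = λ p → p k
  ; fun-op = λ f as → IsEquivalence.refl (isEquiv (E k)) }

FinGen : ∀ {σ} → Algebra σ → Set
FinGen {σ} A = Σ ℕ λ n → Σ (Fin n → Carrier A) λ gens →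
  ∀ a → Σ (Term σ (Fin n)) λ t → _≈_ A (eval A gens t) a

OneGen : ∀ {σ} → Algebra σ → Set
OneGen {σ} A = Σ (Carrier A) λ g →
  ∀ a → Σ (Term σ ⊤) λ t → _≈_ A (eval A (λ _ → g) t) a

Retract : ∀ {σ} → Algebra σ → Algebra σ → Set
Retract P B = Σ (Hom P B) λ i → Σ (Hom B P) λ j → (j ∘H i) ≗H idH P

Projective : (V : Variety) → Algebra (sig V) → Set₁
Projective V P = Σ Set λ X → Retract P (Free V X)

-- exact in V: finitely generated and isomorphic to a subalgebra of a
-- finitely generated free algebra, i.e. embeddable into some F_V(Fin n)
Exact : (V : Variety) → Algebra (sig V) → Set
Exact V A = FinGen A ×
  (Σ ℕ λ n → Σ (Hom A (Free V (Fin n))) λ e → Injective e)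

StronglyProjective : (V : Variety) → Algebra (sig V) → Set₁
StronglyProjective V S = Projective V S ×
  (∀ (P : Algebra (sig V)) → Projective V P → (i : Hom S P) → Injective i →
     Σ (Hom P S) λ j → (j ∘H i) ≗H idH S)

OneESP : Variety → Set₁
OneESP V = ∀ (E : Algebra (sig V)) → OneGen E → Exact V E → StronglyProjective V E

record EGenProblem (V : Variety) : Set₁ where
  field
    m'     : ℕ                       -- m = suc m' ≥ 1
    E      : Fin (suc m') → Algebra (sig V)
    E-1gen : ∀ k → OneGen (E k)
    E-exact : ∀ k → Exact V (E k)
    h      : Hom (F₁ V) (Π E)
    h-surj : ∀ k → Surjective (proj E k ∘H h)
open EGenProblem public

record Solution {V : Variety} (H : EGenProblem V) : Set₁ where
  field
    P      : Algebra (sig V)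
    P-fg   : FinGen P
    P-proj : Projective V P
    g      : Hom (F₁ V) P
    f      : Hom P (Π (E H))
    fact   : (f ∘H g) ≗H h H
open Solution public

_⊑_ : ∀ {V} {H : EGenProblem V} → Solution H → Solution H → Set
s ⊑ s' = Σ (Hom (P s') (P s)) λ f → (f ∘H g s') ≗H g s

_⊆ker_ : ∀ {V} {H : EGenProblem V} → Solution H → Solution H → Set
_⊆ker_ {V} s s' = ∀ (x y : Term (sig V) ⊤) →
  _≈_ (P s) (fun (g s) x) (fun (g s) y) → _≈_ (P s') (fun (g s') x) (fun (g s') y)

-- If ker g' ⊆ ker g, then g factors as F_V(z) → F_V(z)/ker g' → P, and the
-- quotient F_V(z)/ker g' is the image of g' inside the finitely generated
-- projective algebra P'.  Such a P' embeds into a finitely generated free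
-- algebra, so the image is 1-generated and exact, hence strongly projective
-- by 1ESP: its inclusion into P' has a retraction r, and (F_V(z)/ker g' → P) ∘ r
-- witnesses g ⊑ g'.
module Submission where

open import Defs
open import Data.Product using (Σ; _×_; _,_; proj₁; proj₂)
open import Data.Nat using (ℕ)
open import Data.Fin using (Fin; zero)
open import Data.Unit using (⊤; tt)
open import Relation.Binary using (IsEquivalence)
open import Relation.Binary.Bundles using (Setoid)
import Relation.Binary.Reasoning.Setoid as SetoidReasoning

module _ {σ : Signature} (A : Algebra σ) where

  setoid : Setoid _ _
  setoid = record { Carrier = Carrier A ; _≈_ = _≈_ A ; isEquivalence = isEquiv A }

  open IsEquivalence (isEquiv A) public
    using () renaming (refl to ≈-refl; sym to ≈-sym; trans to ≈-trans)

  eval-cong : ∀ {X} {v w : X → Carrier A} → (∀ x → _≈_ A (v x) (w x)) →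
              ∀ t → _≈_ A (eval A v t) (eval A w t)
  eval-cong p (var x)   = p x
  eval-cong p (op f ts) = ⟦⟧-cong A f (λ i → eval-cong p (ts i))

  eval-subst : ∀ {X Y} (v : Y → Carrier A) (ρ : X → Term σ Y) t →
               _≈_ A (eval A v (subst ρ t)) (eval A (λ x → eval A v (ρ x)) t)
  eval-subst v ρ (var x)   = ≈-refl
  eval-subst v ρ (op f ts) = ⟦⟧-cong A f (λ i → eval-subst v ρ (ts i))

module ≈-Reasoning {σ : Signature} (A : Algebra σ) = SetoidReasoning (setoid A)

fun-eval : ∀ {σ} {A B : Algebra σ} (h : Hom A B) {X} (v : X → Carrier A) t →
           _≈_ B (fun h (eval A v t)) (eval B (λ x → fun h (v x)) t)
fun-eval {B = B} h v (var x)   = ≈-refl B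
fun-eval {B = B} h v (op f ts) =
  ≈-trans B (fun-op h f _) (⟦⟧-cong B f (λ i → fun-eval h v (ts i)))

∘H-injective : ∀ {σ} {A B C : Algebra σ} (g : Hom B C) (f : Hom A B) →
               Injective g → Injective f → Injective (g ∘H f)
∘H-injective g f g-inj f-inj a b p = f-inj a b (g-inj _ _ p)

section-injective : ∀ {σ} {A B : Algebra σ} (i : Hom A B) (r : Hom B A) →
                    (r ∘H i) ≗H idH A → Injective i
section-injective {A = A} i r ri a b p = begin
  a               ≈⟨ ≈-sym A (ri a) ⟩
  fun r (fun i a) ≈⟨ fun-cong r p ⟩
  fun r (fun i b) ≈⟨ ri b ⟩
  b               ∎
  where open ≈-Reasoning A

oneGen⇒finGen : ∀ {σ} (A : Algebra σ) → OneGen A → FinGen A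
oneGen⇒finGen A (x , gen) = 1 , (λ _ → x) , λ a →
  let (t , t≈a) = gen a in
  subst (λ _ → var zero) t , ≈-trans A (eval-subst A _ _ t) t≈a

module _ (V : Variety) where

  eval-free : ∀ {X Y} (w : X → Term (sig V) Y) t → V ⊢ eval (Free V Y) w t ≈ subst w t
  eval-free w (var x)   = ≈refl
  eval-free w (op f ts) = ≈cong f (λ i → eval-free w (ts i))

  subst-var : ∀ {X} (t : Term (sig V) X) → V ⊢ subst var t ≈ t
  subst-var (var x)   = ≈refl
  subst-var (op f ts) = ≈cong f (λ i → subst-var (ts i))

  subst-subst : ∀ {X Y Z} (ρ : Y → Term (sig V) Z) (τ : X → Term (sig V) Y) t →
                V ⊢ subst ρ (subst τ t) ≈ subst (λ x → subst ρ (τ x)) t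
  subst-subst ρ τ (var x)   = ≈refl
  subst-subst ρ τ (op f ts) = ≈cong f (λ i → subst-subst ρ τ (ts i))

  subst-cong : ∀ {X Y} (ρ : X → Term (sig V) Y) {s t} →
               V ⊢ s ≈ t → V ⊢ subst ρ s ≈ subst ρ t
  subst-cong ρ ≈refl        = ≈refl
  subst-cong ρ (≈sym p)     = ≈sym (subst-cong ρ p)
  subst-cong ρ (≈trans p q) = ≈trans (subst-cong ρ p) (subst-cong ρ q)
  subst-cong ρ (≈cong f ps) = ≈cong f (λ i → subst-cong ρ (ps i))
  subst-cong ρ (≈axiom e τ) =
    ≈trans (subst-subst ρ τ (lhs V e))
      (≈trans (≈axiom e (λ x → subst ρ (τ x))) (≈sym (subst-subst ρ τ (rhs V e))))

  substH : ∀ {X Y} → (X → Term (sig V) Y) → Hom (Free V X) (Free V Y)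
  substH ρ = record { fun = subst ρ ; fun-cong = subst-cong ρ ; fun-op = λ f as → ≈refl }

  Models : Algebra (sig V) → Set
  Models A = ∀ e (v : ℕ → Carrier A) → _≈_ A (eval A v (lhs V e)) (eval A v (rhs V e))

  free-models : ∀ X → Models (Free V X)
  free-models X e v =
    ≈trans (eval-free v (lhs V e)) (≈trans (≈axiom e v) (≈sym (eval-free v (rhs V e))))

  injective-models : ∀ {A B : Algebra (sig V)} (i : Hom A B) →
                     Injective i → Models B → Models A
  injective-models {A} {B} i i-inj B⊨V e v = i-inj _ _ (begin
    fun i (eval A v (lhs V e))           ≈⟨ fun-eval i v (lhs V e) ⟩
    eval B (λ x → fun i (v x)) (lhs V e) ≈⟨ B⊨V e _ ⟩
    eval B (λ x → fun i (v x)) (rhs V e) ≈⟨ ≈-sym B (fun-eval i v (rhs V e)) ⟩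
    fun i (eval A v (rhs V e))           ∎)
    where open ≈-Reasoning B

  projective-models : ∀ {P : Algebra (sig V)} → Projective V P → Models P
  projective-models (X , i , r , ri) =
    injective-models i (section-injective i r ri) (free-models X)

  eval-sound : ∀ (A : Algebra (sig V)) → Models A → ∀ {X} {s t : Term (sig V) X} →
               V ⊢ s ≈ t → ∀ (v : X → Carrier A) → _≈_ A (eval A v s) (eval A v t)
  eval-sound A A⊨V ≈refl        v = ≈-refl A
  eval-sound A A⊨V (≈sym p)     v = ≈-sym A (eval-sound A A⊨V p v)
  eval-sound A A⊨V (≈trans p q) v = ≈-trans A (eval-sound A A⊨V p v) (eval-sound A A⊨V q v)
  eval-sound A A⊨V (≈cong f ps) v = ⟦⟧-cong A f (λ i → eval-sound A A⊨V (ps i) v)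
  eval-sound A A⊨V (≈axiom e τ) v =
    ≈-trans A (eval-subst A v τ (lhs V e))
      (≈-trans A (A⊨V e _) (≈-sym A (eval-subst A v τ (rhs V e))))

  evalH : ∀ {A : Algebra (sig V)} {X} → Models A → (X → Carrier A) → Hom (Free V X) A
  evalH {A} A⊨V v = record
    { fun = eval A v ; fun-cong = λ p → eval-sound A A⊨V p v
    ; fun-op = λ f as → ≈-refl A }

  -- The retraction r : F_V(X) → P factors through F_V(n) by sending each x to a
  -- term in the n generators denoting r(x).
  finGen-projective-embeds : ∀ (P : Algebra (sig V)) → FinGen P → Projective V P →
    Σ ℕ λ n → Σ (Hom P (Free V (Fin n))) Injective
  finGen-projective-embeds P (n , gens , gen) P-proj@(X , i , r , ri) =
    n , substH name ∘H i , section-injective (substH name ∘H i) (evalH P⊨V gens) back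
    where
      P⊨V = projective-models P-proj
      name : X → Term (sig V) (Fin n)
      name x = proj₁ (gen (fun r (var x)))

      eval-name : ∀ u → _≈_ P (eval P gens (subst name u)) (fun r u)
      eval-name u = begin
        eval P gens (subst name u)            ≈⟨ eval-subst P gens name u ⟩
        eval P (λ x → eval P gens (name x)) u ≈⟨ eval-cong P (λ x → proj₂ (gen (fun r (var x)))) u ⟩
        eval P (λ x → fun r (var x)) u        ≈⟨ ≈-sym P (fun-eval r var u) ⟩
        fun r (eval (Free V X) var u)         ≈⟨ fun-cong r (≈trans (eval-free var u) (subst-var u)) ⟩
        fun r u                               ∎
        where open ≈-Reasoning P

      back : (evalH P⊨V gens ∘H (substH name ∘H i)) ≗H idH P
      back a = ≈-trans P (eval-name (fun i a)) (ri a)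

  -- F_V(z)/ker g, presented as the term algebra with the equality pulled back along g.
  Image₁ : ∀ {B : Algebra (sig V)} → Hom (F₁ V) B → Algebra (sig V)
  Image₁ {B} g = record
    { Carrier = Term (sig V) ⊤
    ; _≈_ = λ x y → _≈_ B (fun g x) (fun g y)
    ; isEquiv = record { refl = ≈-refl B ; sym = ≈-sym B ; trans = ≈-trans B }
    ; ⟦_⟧ = op
    ; ⟦⟧-cong = λ f ps → ≈-trans B (fun-op g f _)
                           (≈-trans B (⟦⟧-cong B f ps) (≈-sym B (fun-op g f _))) }

  module _ {B : Algebra (sig V)} (g : Hom (F₁ V) B) where

    image-inclusion : Hom (Image₁ g) B
    image-inclusion = record { fun = fun g ; fun-cong = λ p → p ; fun-op = fun-op g }

    image-inclusion-injective : Injective image-inclusion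
    image-inclusion-injective a b p = p

    image-oneGen : OneGen (Image₁ g)
    image-oneGen = var tt , λ t → t , eval-var t
      where
        eval-var : ∀ t → _≈_ (Image₁ g) (eval (Image₁ g) (λ _ → var tt) t) t
        eval-var (var tt)  = ≈-refl B
        eval-var (op f ts) = ⟦⟧-cong (Image₁ g) f (λ i → eval-var (ts i))

    image-exact : FinGen B → Projective V B → Exact V (Image₁ g)
    image-exact B-fg B-proj =
      let (n , e , e-inj) = finGen-projective-embeds B B-fg B-proj in
      oneGen⇒finGen (Image₁ g) image-oneGen ,
      n , e ∘H image-inclusion , ∘H-injective e image-inclusion e-inj image-inclusion-injective

    image-lift : ∀ {C : Algebra (sig V)} (k : Hom (F₁ V) C) →
      (∀ x y → _≈_ B (fun g x) (fun g y) → _≈_ C (fun k x) (fun k y)) →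
      Hom (Image₁ g) C
    image-lift k ker⊆ = record
      { fun = fun k ; fun-cong = λ {a} {b} → ker⊆ a b ; fun-op = fun-op k }

module _ {V : Variety} {H : EGenProblem V} where

  ⊑⇒⊆ker : (s s' : Solution H) → s ⊑ s' → s' ⊆ker s
  ⊑⇒⊆ker s s' (f , fg'≗g) x y p = begin
    fun (g s) x          ≈⟨ ≈-sym (P s) (fg'≗g x) ⟩
    fun f (fun (g s') x) ≈⟨ fun-cong f p ⟩
    fun f (fun (g s') y) ≈⟨ fg'≗g y ⟩
    fun (g s) y          ∎
    where open ≈-Reasoning (P s)

  ⊆ker⇒⊑ : OneESP V → (s s' : Solution H) → s' ⊆ker s → s ⊑ s'
  ⊆ker⇒⊑ esp s s' ker⊆ = image-lift V (g s') (g s) ker⊆ ∘H r , λ x → ker⊆ _ _ (ri x)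
    where
      S : Algebra (sig V)
      S = Image₁ V (g s')

      ι : Hom S (P s')
      ι = image-inclusion V (g s')

      S-strongly-projective : StronglyProjective V S
      S-strongly-projective =
        esp S (image-oneGen V (g s')) (image-exact V (g s') (P-fg s') (P-proj s'))

      retraction : Σ (Hom (P s') S) λ r → (r ∘H ι) ≗H idH S
      retraction = proj₂ S-strongly-projective (P s') (P-proj s') ι
                     (image-inclusion-injective V (g s'))

      r : Hom (P s') S
      r = proj₁ retraction

      ri : (r ∘H ι) ≗H idH S
      ri = proj₂ retraction

theorem4p19 : (V : Variety) → OneESP V → (H : EGenProblem V) →
    (s s' : Solution H) → ((s ⊑ s' → s' ⊆ker s) × (s' ⊆ker s → s ⊑ s'))
theorem4p19 V esp H s s' = ⊑⇒⊆ker s s' , ⊆ker⇒⊑ esp s s'
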